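{- Let $B_{11}$ and $B_{12}$ be the graphs on vertex set $\{1,\dots,18\}$ with edge sets $B_{11}$: $\{2,4\},\{3,4\},\{1,2\},\{1,5\},\{3,5\},\{6,8\},\{16,18\},\{16,17\},\{6,7\},\{2,7\},\{1,8\},\{4,9\},\{5,10\},\{11,15\},\{14,15\},\{12,14\},\{12,13\},\{11,13\},\{14,17\},\{13,16\},\{15,18\},\{8,9\},\{7,10\},\{9,11\},\{6,12\},\{3,18\},\{10,17\}$; $B_{12}$: $\{2,4\},\{3,4\},\{1,2\},\{1,5\},\{3,5\},\{3,6\},\{6,8\},\{8,18\},\{16,18\},\{16,17\},\{7,17\},\{6,7\},\{2,7\},\{1,8\},\{4,9\},\{9,12\},\{5,10\},\{10,11\},\{11,15\},\{14,15\},\{12,14\},\{12,13\},\{11,13\},\{14,17\},\{13,16\},\{15,18\},\{9,10\}$. For each $G \in \{B_{11},B_{12}\}$ there exists a decomposition of the complete tripartite graph $K_{9,9,9}$ into $G$.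
   Context: All graphs are simple. A decomposition of a graph $K$ into $G$ is a partition of the edge set of $K$ into edge sets of subgraphs each isomorphic to $G$. $B_{11}$ and $B_{12}$ are the two 18-vertex Blanuša snarks. -}

module Defs where

open import Data.Nat as ℕ using (ℕ; pred)
open import Data.Fin using (Fin; #_)
open import Data.List using (List; []; _∷_)
open import Data.List.Membership.Propositional using (_∈_)
open import Data.Product using (Σ; ∃; _×_; _,_)
open import Data.Sum using (_⊎_)
open import Relation.Binary.PropositionalEquality using (_≡_)
open import Relation.Nullary using (¬_)
open import Relation.Nullary.Decidable using (True)
open import Function.Definitions using (Injective)

-- Finite simple graphs on vertex set Fin n, given by a list of edges
-- (each unordered edge {u,v} listed once as a pair).

EdgeList : ℕ → Set
EdgeList n = List (Fin n × Fin n)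

-- Paper's 1-based vertex label k ∈ {1..18} ↦ Fin 18 index k-1.
v : (k : ℕ) {p : True (pred k ℕ.<? 18)} → Fin 18
v k {p} = #_ (pred k) {18} {p}

B11 : EdgeList 18
B11 =
  (v 2 , v 4) ∷ (v 3 , v 4) ∷ (v 1 , v 2) ∷ (v 1 , v 5) ∷ (v 3 , v 5) ∷
  (v 6 , v 8) ∷ (v 16 , v 18) ∷ (v 16 , v 17) ∷ (v 6 , v 7) ∷ (v 2 , v 7) ∷
  (v 1 , v 8) ∷ (v 4 , v 9) ∷ (v 5 , v 10) ∷ (v 11 , v 15) ∷ (v 14 , v 15) ∷
  (v 12 , v 14) ∷ (v 12 , v 13) ∷ (v 11 , v 13) ∷ (v 14 , v 17) ∷ (v 13 , v 16) ∷
  (v 15 , v 18) ∷ (v 8 , v 9) ∷ (v 7 , v 10) ∷ (v 9 , v 11) ∷ (v 6 , v 12) ∷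
  (v 3 , v 18) ∷ (v 10 , v 17) ∷ []

B12 : EdgeList 18
B12 =
  (v 2 , v 4) ∷ (v 3 , v 4) ∷ (v 1 , v 2) ∷ (v 1 , v 5) ∷ (v 3 , v 5) ∷
  (v 3 , v 6) ∷ (v 6 , v 8) ∷ (v 8 , v 18) ∷ (v 16 , v 18) ∷ (v 16 , v 17) ∷
  (v 7 , v 17) ∷ (v 6 , v 7) ∷ (v 2 , v 7) ∷ (v 1 , v 8) ∷ (v 4 , v 9) ∷
  (v 9 , v 12) ∷ (v 5 , v 10) ∷ (v 10 , v 11) ∷ (v 11 , v 15) ∷ (v 14 , v 15) ∷
  (v 12 , v 14) ∷ (v 12 , v 13) ∷ (v 11 , v 13) ∷ (v 14 , v 17) ∷ (v 13 , v 16) ∷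
  (v 15 , v 18) ∷ (v 9 , v 10) ∷ []

K999-V : Set
K999-V = Fin 3 × Fin 9

K999-Adj : K999-V → K999-V → Set
K999-Adj (i , _) (j , _) = ¬ (i ≡ j)

-- A subgraph of the host isomorphic to G: an injective vertex map sending
-- every edge of G to an edge of the host (the subgraph consists of the
-- images of the vertices and edges of G).
record Copy {n : ℕ} (E : EdgeList n) (V : Set) (Adj : V → V → Set) : Set where
  field
    f     : Fin n → V
    inj   : Injective _≡_ _≡_ f
    edges : ∀ {a b} → (a , b) ∈ E → Adj (f a) (f b)

InCopy : {n : ℕ} {E : EdgeList n} {V : Set} {Adj : V → V → Set} →
         Copy E V Adj → V → V → Set
InCopy {E = E} c x y =
  ∃ λ ab → ab ∈ E × let (a , b) = ab in
    ((Copy.f c a ≡ x × Copy.f c b ≡ y) ⊎ (Copy.f c a ≡ y × Copy.f c b ≡ x))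

Decomposition : {n : ℕ} (E : EdgeList n) (V : Set) (Adj : V → V → Set) → Set
Decomposition E V Adj =
  Σ ℕ λ m → Σ (Fin m → Copy E V Adj) λ cs →
    ∀ x y → Adj x y →
      ∃ λ i → InCopy (cs i) x y × (∀ j → InCopy (cs j) x y → j ≡ i)

-- Both decompositions are ℤ₉-cyclic. Identify each part of K₉,₉,₉ with ℤ₉ and
-- let ℤ₉ act by translation, which preserves parts. Give every ordered pair of
-- vertices (p , i), (q , j) in different parts the difference (p , q , j − i);
-- it is translation invariant, and two such pairs with the same difference are
-- related by exactly one translation. So if the 27 edges of a copy of G,
-- taken in both orientations, realise each of the 54 mixed differences exactly
-- once, every edge of K₉,₉,₉ lies in exactly one of the 9 translates of the copy.

module Submission where

open import Defs
open import Data.Fin using (Fin; toℕ; #_)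
open import Data.Fin.Properties using (toℕ-injective; toℕ-fromℕ<; toℕ<n; all?) renaming (_≟_ to _≟ᶠ_)
open import Data.List using (List; _++_; map)
open import Data.List.Membership.Propositional using (_∈_; find; lose)
open import Data.List.Membership.Propositional.Properties using (∈-++⁺ˡ; ∈-++⁺ʳ; ∈-++⁻; ∈-map⁺; ∈-map⁻)
open import Data.List.Relation.Unary.All as All using (All)
open import Data.List.Relation.Unary.Any as Any using (Any)
open import Data.Nat using (ℕ; NonZero; _+_; _∸_; _%_)
open import Data.Nat.DivMod using (_mod_; %-distribˡ-+; m%n%n≡m%n; [m+n]%n≡m%n; m<n⇒m%n≡m)
open import Data.Nat.Properties using (+-comm; +-assoc; m∸n+n≡m; <⇒≤)
open import Data.Product using (∃; _×_; _,_; proj₁; proj₂; swap)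
open import Data.Product.Properties using (≡-dec; ,-injective)
open import Data.Sum using (inj₁; inj₂)
open import Data.Vec using (Vec; lookup; _∷_; [])
open import Function using (_∘_)
open import Function.Definitions using (Injective)
open import Relation.Binary using (DecidableEquality)
open import Relation.Binary.PropositionalEquality
open import Relation.Nullary using (¬_; Dec; map′; ¬?)
open import Relation.Nullary.Decidable using (toWitness; _×-dec_; _→-dec_)

[m%d+n]%d≡[m+n]%d : ∀ m n d .{{_ : NonZero d}} → (m % d + n) % d ≡ (m + n) % d
[m%d+n]%d≡[m+n]%d m n d = begin
  (m % d + n) % d         ≡⟨ %-distribˡ-+ (m % d) n d ⟩
  (m % d % d + n % d) % d ≡⟨ cong (λ r → (r + n % d) % d) (m%n%n≡m%n m d) ⟩
  (m % d + n % d) % d     ≡⟨ %-distribˡ-+ m n d ⟨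
  (m + n) % d             ∎
  where open ≡-Reasoning

module _ {n : ℕ} .{{_ : NonZero n}} where

  infixl 6 _⊕_ _⊖_

  _⊕_ : Fin n → Fin n → Fin n
  i ⊕ j = (toℕ i + toℕ j) mod n

  _⊖_ : Fin n → Fin n → Fin n
  j ⊖ i = (toℕ j + (n ∸ toℕ i)) mod n

  private
    toℕ-mod : ∀ m → toℕ (m mod n) ≡ m % n
    toℕ-mod m = toℕ-fromℕ< _

    toℕ-⊕-mod : ∀ i j k → toℕ (i ⊕ j ⊕ k) ≡ (toℕ i + toℕ j + toℕ k) % n
    toℕ-⊕-mod i j k = begin
      toℕ (i ⊕ j ⊕ k)                    ≡⟨ toℕ-mod _ ⟩
      (toℕ (i ⊕ j) + toℕ k) % n          ≡⟨ cong (λ r → (r + toℕ k) % n) (toℕ-mod _) ⟩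
      ((toℕ i + toℕ j) % n + toℕ k) % n  ≡⟨ [m%d+n]%d≡[m+n]%d (toℕ i + toℕ j) (toℕ k) n ⟩
      (toℕ i + toℕ j + toℕ k) % n        ∎
      where open ≡-Reasoning

    [j+[n∸i]+i]%n≡j : ∀ i j → (toℕ j + (n ∸ toℕ i) + toℕ i) % n ≡ toℕ j
    [j+[n∸i]+i]%n≡j i j = begin
      (toℕ j + (n ∸ toℕ i) + toℕ i) % n ≡⟨ cong (_% n) (+-assoc (toℕ j) _ _) ⟩
      (toℕ j + (n ∸ toℕ i + toℕ i)) % n ≡⟨ cong (λ r → (toℕ j + r) % n) (m∸n+n≡m (<⇒≤ (toℕ<n i))) ⟩
      (toℕ j + n) % n                   ≡⟨ [m+n]%n≡m%n (toℕ j) n ⟩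
      toℕ j % n                         ≡⟨ m<n⇒m%n≡m (toℕ<n j) ⟩
      toℕ j                             ∎
      where open ≡-Reasoning

  ⊕-comm : ∀ i j → i ⊕ j ≡ j ⊕ i
  ⊕-comm i j = cong (λ m → m mod n) (+-comm (toℕ i) (toℕ j))

  [i⊕j]⊕k≡[i⊕k]⊕j : ∀ i j k → i ⊕ j ⊕ k ≡ i ⊕ k ⊕ j
  [i⊕j]⊕k≡[i⊕k]⊕j i j k = toℕ-injective (begin
    toℕ (i ⊕ j ⊕ k)              ≡⟨ toℕ-⊕-mod i j k ⟩
    (toℕ i + toℕ j + toℕ k) % n  ≡⟨ cong (_% n) (+-assoc (toℕ i) _ _) ⟩
    (toℕ i + (toℕ j + toℕ k)) % n ≡⟨ cong (λ r → (toℕ i + r) % n) (+-comm (toℕ j) _) ⟩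
    (toℕ i + (toℕ k + toℕ j)) % n ≡⟨ cong (_% n) (+-assoc (toℕ i) _ _) ⟨
    (toℕ i + toℕ k + toℕ j) % n  ≡⟨ toℕ-⊕-mod i k j ⟨
    toℕ (i ⊕ k ⊕ j)              ∎)
    where open ≡-Reasoning

  i⊕[j⊖i]≡j : ∀ i j → i ⊕ (j ⊖ i) ≡ j
  i⊕[j⊖i]≡j i j = toℕ-injective (begin
    toℕ (i ⊕ (j ⊖ i))                      ≡⟨ cong toℕ (⊕-comm i (j ⊖ i)) ⟩
    toℕ (j ⊖ i ⊕ i)                        ≡⟨ toℕ-mod _ ⟩
    (toℕ (j ⊖ i) + toℕ i) % n              ≡⟨ cong (λ r → (r + toℕ i) % n) (toℕ-mod _) ⟩
    ((toℕ j + (n ∸ toℕ i)) % n + toℕ i) % n ≡⟨ [m%d+n]%d≡[m+n]%d _ (toℕ i) n ⟩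
    (toℕ j + (n ∸ toℕ i) + toℕ i) % n      ≡⟨ [j+[n∸i]+i]%n≡j i j ⟩
    toℕ j                                  ∎)
    where open ≡-Reasoning

  [i⊕j]⊖i≡j : ∀ i j → i ⊕ j ⊖ i ≡ j
  [i⊕j]⊖i≡j i j = toℕ-injective (begin
    toℕ (i ⊕ j ⊖ i)                          ≡⟨ toℕ-mod _ ⟩
    (toℕ (i ⊕ j) + (n ∸ toℕ i)) % n          ≡⟨ cong (λ r → (r + (n ∸ toℕ i)) % n) (toℕ-mod _) ⟩
    ((toℕ i + toℕ j) % n + (n ∸ toℕ i)) % n  ≡⟨ [m%d+n]%d≡[m+n]%d (toℕ i + toℕ j) _ n ⟩
    (toℕ i + toℕ j + (n ∸ toℕ i)) % n        ≡⟨ cong (λ r → (r + (n ∸ toℕ i)) % n) (+-comm (toℕ i) _) ⟩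
    (toℕ j + toℕ i + (n ∸ toℕ i)) % n        ≡⟨ cong (_% n) (+-assoc (toℕ j) _ _) ⟩
    (toℕ j + (toℕ i + (n ∸ toℕ i))) % n      ≡⟨ cong (λ r → (toℕ j + r) % n) (+-comm (toℕ i) _) ⟩
    (toℕ j + (n ∸ toℕ i + toℕ i)) % n        ≡⟨ cong (_% n) (+-assoc (toℕ j) _ _) ⟨
    (toℕ j + (n ∸ toℕ i) + toℕ i) % n        ≡⟨ [j+[n∸i]+i]%n≡j i j ⟩
    toℕ j                                    ∎)
    where open ≡-Reasoning

  ⊕-cancelˡ : ∀ i {j k} → i ⊕ j ≡ i ⊕ k → j ≡ k
  ⊕-cancelˡ i {j} {k} eq = begin
    j         ≡⟨ [i⊕j]⊖i≡j i j ⟨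
    i ⊕ j ⊖ i ≡⟨ cong (_⊖ i) eq ⟩
    i ⊕ k ⊖ i ≡⟨ [i⊕j]⊖i≡j i k ⟩
    k         ∎
    where open ≡-Reasoning

  ⊕-cancelʳ : ∀ i {j k} → j ⊕ i ≡ k ⊕ i → j ≡ k
  ⊕-cancelʳ i {j} {k} eq = ⊕-cancelˡ i (trans (⊕-comm i j) (trans eq (⊕-comm k i)))

  [j⊕k]⊖[i⊕k]≡j⊖i : ∀ i j k → j ⊕ k ⊖ (i ⊕ k) ≡ j ⊖ i
  [j⊕k]⊖[i⊕k]≡j⊖i i j k = ⊕-cancelˡ (i ⊕ k) (begin
    i ⊕ k ⊕ (j ⊕ k ⊖ (i ⊕ k)) ≡⟨ i⊕[j⊖i]≡j (i ⊕ k) (j ⊕ k) ⟩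
    j ⊕ k                     ≡⟨ cong (_⊕ k) (i⊕[j⊖i]≡j i j) ⟨
    i ⊕ (j ⊖ i) ⊕ k           ≡⟨ [i⊕j]⊕k≡[i⊕k]⊕j i (j ⊖ i) k ⟩
    i ⊕ k ⊕ (j ⊖ i)           ∎)
    where open ≡-Reasoning

  ⊖-translate : ∀ {i j i′ j′} → j ⊖ i ≡ j′ ⊖ i′ → ∃ λ t → i ⊕ t ≡ i′ × j ⊕ t ≡ j′
  ⊖-translate {i} {j} {i′} {j′} eq = i′ ⊖ i , i⊕[j⊖i]≡j i i′ , (begin
    j ⊕ (i′ ⊖ i)           ≡⟨ cong (_⊕ (i′ ⊖ i)) (i⊕[j⊖i]≡j i j) ⟨
    i ⊕ (j ⊖ i) ⊕ (i′ ⊖ i) ≡⟨ [i⊕j]⊕k≡[i⊕k]⊕j i (j ⊖ i) (i′ ⊖ i) ⟩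
    i ⊕ (i′ ⊖ i) ⊕ (j ⊖ i) ≡⟨ cong₂ _⊕_ (i⊕[j⊖i]≡j i i′) eq ⟩
    i′ ⊕ (j′ ⊖ i′)         ≡⟨ i⊕[j⊖i]≡j i′ j′ ⟩
    j′                     ∎)
    where open ≡-Reasoning

module _ {P : Set} {n : ℕ} where

  Mixed : P × Fin n → P × Fin n → Set
  Mixed x y = ¬ proj₁ x ≡ proj₁ y

  module _ .{{_ : NonZero n}} where

    rotate : Fin n → P × Fin n → P × Fin n
    rotate t (p , i) = p , i ⊕ t

    difference : P × Fin n → P × Fin n → P × P × Fin n
    difference (p , i) (q , j) = p , q , j ⊖ i

    rotate-injective : ∀ t → Injective _≡_ _≡_ (rotate t)
    rotate-injective t {p , i} {q , j} eq with ,-injective eq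
    ... | refl , i⊕t≡j⊕t = cong (p ,_) (⊕-cancelʳ t i⊕t≡j⊕t)

    rotate-cancel : ∀ {s t} x → rotate s x ≡ rotate t x → s ≡ t
    rotate-cancel (p , i) eq = ⊕-cancelˡ i (proj₂ (,-injective eq))

    difference-rotate : ∀ t x y → difference (rotate t x) (rotate t y) ≡ difference x y
    difference-rotate t (p , i) (q , j) = cong (λ d → p , q , d) ([j⊕k]⊖[i⊕k]≡j⊖i i j t)

    difference-translate : ∀ u w x y → difference u w ≡ difference x y →
                           ∃ λ t → rotate t u ≡ x × rotate t w ≡ y
    difference-translate (p , i) (q , j) (p′ , i′) (q′ , j′) eq
      with ,-injective eq
    ... | refl , eq′ with ,-injective eq′
    ... | refl , j⊖i≡j′⊖i′ with ⊖-translate j⊖i≡j′⊖i′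
    ... | t , i⊕t≡i′ , j⊕t≡j′ = t , cong (p ,_) i⊕t≡i′ , cong (q ,_) j⊕t≡j′

arcs : {A : Set} → List (A × A) → List (A × A)
arcs E = E ++ map swap E

module _ {m : ℕ} {E : EdgeList m} {V : Set} {Adj : V → V → Set} (c : Copy E V Adj) where

  open Copy c

  InCopy⇒arc : ∀ {x y} → InCopy c x y → ∃ λ e → e ∈ arcs E × f (proj₁ e) ≡ x × f (proj₂ e) ≡ y
  InCopy⇒arc ((a , b) , ab∈E , inj₁ (fa≡x , fb≡y)) = (a , b) , ∈-++⁺ˡ ab∈E , fa≡x , fb≡y
  InCopy⇒arc ((a , b) , ab∈E , inj₂ (fa≡y , fb≡x)) = (b , a) , ∈-++⁺ʳ E (∈-map⁺ swap ab∈E) , fb≡x , fa≡y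

  arc⇒InCopy : ∀ {e x y} → e ∈ arcs E → f (proj₁ e) ≡ x → f (proj₂ e) ≡ y → InCopy c x y
  arc⇒InCopy {e} e∈ fa≡x fb≡y with ∈-++⁻ E e∈
  ... | inj₁ e∈E = e , e∈E , inj₁ (fa≡x , fb≡y)
  ... | inj₂ e∈swapE with ∈-map⁻ swap e∈swapE
  ...   | (a , b) , ab∈E , refl = (a , b) , ab∈E , inj₂ (fb≡y , fa≡x)

module _ {m : ℕ} {P : Set} {n : ℕ} .{{_ : NonZero n}} where

  arcDifference : (Fin m → P × Fin n) → Fin m × Fin m → P × P × Fin n
  arcDifference φ (a , b) = difference (φ a) (φ b)

  record IsBaseBlock (E : EdgeList m) (φ : Fin m → P × Fin n) : Set where
    field
      injective            : Injective _≡_ _≡_ φ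
      edges-mixed          : ∀ {a b} → (a , b) ∈ E → Mixed (φ a) (φ b)
      differences-distinct : ∀ {e e′} → e ∈ arcs E → e′ ∈ arcs E →
                             arcDifference φ e ≡ arcDifference φ e′ → e ≡ e′
      differences-cover    : ∀ p q d → ¬ p ≡ q →
                             ∃ λ e → e ∈ arcs E × arcDifference φ e ≡ (p , q , d)

  module _ {E : EdgeList m} {φ : Fin m → P × Fin n} (base : IsBaseBlock E φ) where

    open IsBaseBlock base

    translate : Fin n → Copy E (P × Fin n) Mixed
    translate t = record
      { f     = rotate t ∘ φ
      ; inj   = injective ∘ rotate-injective t
      ; edges = edges-mixed
      }

    edge-in-unique-translate : ∀ x y → Mixed x y →
      ∃ λ t → InCopy (translate t) x y × (∀ s → InCopy (translate s) x y → s ≡ t)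
    edge-in-unique-translate x@(p , i) y@(q , j) p≢q
      with differences-cover p q (j ⊖ i) p≢q
    ... | (a , b) , ab∈ , δab≡δxy with difference-translate (φ a) (φ b) x y δab≡δxy
    ... | t , φa↦x , φb↦y = t , arc⇒InCopy (translate t) ab∈ φa↦x φb↦y , unique
      where
      open ≡-Reasoning

      unique : ∀ s → InCopy (translate s) x y → s ≡ t
      unique s x-y∈s with InCopy⇒arc (translate s) x-y∈s
      ... | (a′ , b′) , ab′∈ , φa′↦x , φb′↦y
        with differences-distinct ab′∈ ab∈ (begin
               difference (φ a′) (φ b′)                       ≡⟨ difference-rotate s (φ a′) (φ b′) ⟨
               difference (rotate s (φ a′)) (rotate s (φ b′)) ≡⟨ cong₂ difference φa′↦x φb′↦y ⟩
               difference x y                                 ≡⟨ δab≡δxy ⟨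
               difference (φ a) (φ b)                         ∎)
      ... | refl = rotate-cancel (φ a) (trans φa′↦x (sym φa↦x))

    cyclicDecomposition : Decomposition E (P × Fin n) Mixed
    cyclicDecomposition = n , translate , edge-in-unique-translate

module _ {m k n : ℕ} .{{_ : NonZero n}} (E : EdgeList m) (φ : Fin m → Fin k × Fin n) where

  private
    _≟ᵛ_ : DecidableEquality (Fin k × Fin n)
    _≟ᵛ_ = ≡-dec _≟ᶠ_ _≟ᶠ_

    _≟ᵉ_ : DecidableEquality (Fin m × Fin m)
    _≟ᵉ_ = ≡-dec _≟ᶠ_ _≟ᶠ_

    _≟ᵈ_ : DecidableEquality (Fin k × Fin k × Fin n)
    _≟ᵈ_ = ≡-dec _≟ᶠ_ (≡-dec _≟ᶠ_ _≟ᶠ_)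

    Checks : Set
    Checks = (∀ a b → φ a ≡ φ b → a ≡ b)
           × All (λ e → Mixed (φ (proj₁ e)) (φ (proj₂ e))) E
           × All (λ e → All (λ e′ → arcDifference φ e ≡ arcDifference φ e′ → e ≡ e′) (arcs E)) (arcs E)
           × (∀ p q d → ¬ p ≡ q → Any (λ e → arcDifference φ e ≡ (p , q , d)) (arcs E))

    checks? : Dec Checks
    checks? =
      all? (λ a → all? (λ b → (φ a ≟ᵛ φ b) →-dec (a ≟ᶠ b)))
      ×-dec All.all? (λ e → ¬? (proj₁ (φ (proj₁ e)) ≟ᶠ proj₁ (φ (proj₂ e)))) E
      ×-dec All.all? (λ e → All.all? (λ e′ → (arcDifference φ e ≟ᵈ arcDifference φ e′) →-dec (e ≟ᵉ e′)) (arcs E)) (arcs E)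
      ×-dec all? (λ p → all? (λ q → all? (λ d →
              ¬? (p ≟ᶠ q) →-dec Any.any? (λ e → arcDifference φ e ≟ᵈ (p , q , d)) (arcs E))))

    fromChecks : Checks → IsBaseBlock E φ
    fromChecks (inj , mixed , distinct , cover) = record
      { injective            = λ {a} {b} → inj a b
      ; edges-mixed          = All.lookup mixed
      ; differences-distinct = λ e∈ e′∈ → All.lookup (All.lookup distinct e∈) e′∈
      ; differences-cover    = λ p q d p≢q → find (cover p q d p≢q)
      }

    toChecks : IsBaseBlock E φ → Checks
    toChecks base =
        (λ a b → injective)
      , All.tabulate edges-mixed
      , All.tabulate (λ e∈ → All.tabulate (differences-distinct e∈))
      , (λ p q d p≢q → let e , e∈ , δ≡ = differences-cover p q d p≢q in lose e∈ δ≡)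
      where open IsBaseBlock base

  isBaseBlock? : Dec (IsBaseBlock E φ)
  isBaseBlock? = map′ fromChecks toChecks checks?

blanuša₁-base : Vec K999-V 18
blanuša₁-base =
  (# 2 , # 5) ∷ (# 0 , # 2) ∷ (# 2 , # 4) ∷ (# 1 , # 0) ∷ (# 0 , # 4) ∷ (# 1 , # 2) ∷
  (# 2 , # 8) ∷ (# 0 , # 7) ∷ (# 2 , # 0) ∷ (# 1 , # 1) ∷ (# 0 , # 5) ∷ (# 0 , # 8) ∷
  (# 1 , # 4) ∷ (# 1 , # 8) ∷ (# 2 , # 1) ∷ (# 0 , # 3) ∷ (# 2 , # 2) ∷ (# 1 , # 5) ∷ []

blanuša₂-base : Vec K999-V 18
blanuša₂-base =
  (# 2 , # 4) ∷ (# 1 , # 7) ∷ (# 2 , # 3) ∷ (# 0 , # 5) ∷ (# 1 , # 0) ∷ (# 1 , # 4) ∷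
  (# 2 , # 0) ∷ (# 0 , # 7) ∷ (# 2 , # 8) ∷ (# 0 , # 4) ∷ (# 1 , # 5) ∷ (# 1 , # 1) ∷
  (# 0 , # 6) ∷ (# 2 , # 1) ∷ (# 0 , # 2) ∷ (# 1 , # 6) ∷ (# 0 , # 8) ∷ (# 2 , # 7) ∷ []

B11-baseBlock : IsBaseBlock B11 (lookup blanuša₁-base)
B11-baseBlock = toWitness {a? = isBaseBlock? B11 (lookup blanuša₁-base)} _

B12-baseBlock : IsBaseBlock B12 (lookup blanuša₂-base)
B12-baseBlock = toWitness {a? = isBaseBlock? B12 (lookup blanuša₂-base)} _

lemma4 : Decomposition B11 K999-V K999-Adj × Decomposition B12 K999-V K999-Adj
lemma4 = cyclicDecomposition B11-baseBlock , cyclicDecomposition B12-baseBlock
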